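{- $\pi_{\mathrm{ee}}(K_5^{(3)})\geq \frac13$, where $K_5^{(3)}$ is the complete $3$-uniform hypergraph on $5$ vertices.
   Context: For a $3$-uniform hypergraph $H=(V,E)$ on $n$ vertices and $P,Q\subseteq V\times V$, let $\mathcal K(P,Q)$ be the set of pairs in $P\times Q$ of the form $((x,y),(x,z))$ and $e(P,Q)$ the number of these with $\{x,y,z\}\in E$; $H$ is $(d,\eta)$-ee-dense if $e(P,Q)\geq d|\mathcal K(P,Q)|-\eta n^3$ for all $P,Q\subseteq V\times V$. For a $3$-uniform hypergraph $F$, $\pi_{\mathrm{ee}}(F)$ is the supremum of all $d\in[0,1]$ such that for every $\eta>0$ and $n\in\mathbb N$ there is an $F$-free $(d,\eta)$-ee-dense $3$-uniform hypergraph with at least $n$ vertices.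
   Formalization: The parameter η in the definition of $\pi_{\mathrm{ee}}$ ranges only over the positive rationals, and the values d whose supremum is taken are taken in ℚ. -}

module Defs where

open import Data.Nat using (ℕ; zero; suc; _^_; _≥_)
open import Data.Integer using (+_)
open import Data.Fin using (Fin; zero; suc)
open import Data.Fin.Properties using () renaming (_≟_ to _≟ᶠ_)
open import Data.Bool using (Bool; true; false; _∧_; not; if_then_else_)
open import Data.Rational using (ℚ; _/_; _+_; _-_; _*_; _≤_; _<_; 0ℚ; 1ℚ)
open import Data.Product using (Σ; ∃; _×_; _,_)
open import Relation.Binary.PropositionalEquality using (_≡_)
open import Relation.Nullary using (¬_; does)
open import Function.Definitions using (Injective)

ℕ→ℚ : ℕ → ℚ
ℕ→ℚ n = + n / 1

count : {n : ℕ} → (Fin n → Bool) → ℕ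
count {zero}  p = 0
count {suc n} p = (if p zero then 1 else 0) Data.Nat.+ count (λ i → p (suc i))

-- A 3-uniform hypergraph on vertex set Fin n, given by the (Boolean)
-- indicator of its edges as a function of ordered triples.
Edges3 : ℕ → Set
Edges3 n = Fin n → Fin n → Fin n → Bool

-- well-formedness: the indicator depends only on the set {x,y,z},
-- and triples with a repeated vertex are never edges
record IsHypergraph3 {n : ℕ} (E : Edges3 n) : Set where
  field
    sym₁₂ : ∀ x y z → E x y z ≡ E y x z
    sym₂₃ : ∀ x y z → E x y z ≡ E x z y
    loop  : ∀ x z → E x x z ≡ false

record Hypergraph3 (n : ℕ) : Set where
  field
    edge : Edges3 n
    wf   : IsHypergraph3 edge
open Hypergraph3 public

distinct3 : {n : ℕ} → Fin n → Fin n → Fin n → Bool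
distinct3 i j k = not (does (i ≟ᶠ j)) ∧ not (does (j ≟ᶠ k)) ∧ not (does (i ≟ᶠ k))

complete3 : (m : ℕ) → Edges3 m
complete3 m = distinct3

Contains : {m n : ℕ} → Edges3 m → Edges3 n → Set
Contains {m} {n} F H =
  Σ (Fin m → Fin n) λ f → Injective _≡_ _≡_ f ×
    (∀ i j k → F i j k ≡ true → H (f i) (f j) (f k) ≡ true)

Free : {m n : ℕ} → Edges3 m → Edges3 n → Set
Free F H = ¬ Contains F H

PairSet : ℕ → Set
PairSet n = Fin n → Fin n → Bool

sumFin : {n : ℕ} → (Fin n → ℕ) → ℕ
sumFin {zero}  f = 0
sumFin {suc n} f = f zero Data.Nat.+ sumFin (λ i → f (suc i))

ind : Bool → ℕ
ind b = if b then 1 else 0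

-- |𝒦(P,Q)| : number of pairs ((x,y),(x,z)) ∈ P × Q
sizeK : {n : ℕ} → PairSet n → PairSet n → ℕ
sizeK P Q = sumFin λ x → sumFin λ y → sumFin λ z → ind (P x y ∧ Q x z)

-- e(P,Q) : number of those pairs with {x,y,z} ∈ E
ePQ : {n : ℕ} → Edges3 n → PairSet n → PairSet n → ℕ
ePQ E P Q = sumFin λ x → sumFin λ y → sumFin λ z → ind (P x y ∧ Q x z ∧ E x y z)

EEDense : {n : ℕ} → Edges3 n → ℚ → ℚ → Set
EEDense {n} E d η = ∀ (P Q : PairSet n) →
  d * ℕ→ℚ (sizeK P Q) - η * ℕ→ℚ (n ^ 3) ≤ ℕ→ℚ (ePQ E P Q)

Admissible : {m : ℕ} → Edges3 m → ℚ → Set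
Admissible F d = ∀ (η : ℚ) → 0ℚ < η → ∀ (n : ℕ) →
  Σ ℕ λ N → N ≥ n × Σ (Hypergraph3 N) λ H → Free F (edge H) × EEDense (edge H) d η

-- π_ee(F) ≥ c, i.e. sup { d ∈ [0,1] : Admissible F d } ≥ c:
-- for every ε > 0 there is an admissible d ∈ [0,1] with d > c - ε
πee-≥ : {m : ℕ} → Edges3 m → ℚ → Set
πee-≥ F c = ∀ (ε : ℚ) → 0ℚ < ε →
  Σ ℚ λ d → (0ℚ ≤ d × d ≤ 1ℚ) × (c - ε < d) × Admissible F d

module Submission where

-- The hypergraph H_k has vertex set 𝔽₃ᵏ; three distinct vectors x, y, z form an edge iff
-- ⟨x,y⟩ + ⟨x,z⟩ + ⟨y,z⟩ = 1 in 𝔽₃ (⟨,⟩ the standard dot product φ).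
--
-- * K₅-freeness: seen from one vertex x₀ of a K₅, the colours uᵢ = ⟨x₀,xᵢ⟩ of the other four
--   vertices determine ⟨xᵢ,xⱼ⟩, and the remaining four edges would give four inconsistent linear
--   equations over 𝔽₃ (a finite check).
-- * Density: weight each pair ((x,y),(x,z)) of 𝒦(P,Q) by the balanced indicator
--   3·[{x,y,z} satisfies the edge equation] − 1. Splitting the links of x by the values of
--   ⟨x,·⟩, the total weight is a sum of 9N discrepancy sums Σ_{y∈A,z∈B} (3·[⟨y,z⟩ = c] − 1),
--   each O(N^{3/2}) because a nonzero linear functional is equidistributed (Lindsey's lemma).
--   Hence 3·e(P,Q) ≥ |𝒦(P,Q)| − O(N^{5/2}), and for N = 3^{2j} this gives (1/3, η)-ee-density.

open import Defs
open import Data.Integer using (+_)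
open import Data.Rational using (_/_)

open import Data.Bool using (Bool; true; false; _∧_; not)
open import Data.Bool.Properties using (∧-zeroʳ) renaming (_≟_ to _≟ᵇ_)
open import Data.Empty using (⊥; ⊥-elim)
open import Data.Fin using (Fin; zero; suc; _↑ˡ_; _↑ʳ_; combine; quotient; remainder)
open import Data.Fin.Patterns using (0F; 1F; 2F; 3F; 4F)
open import Data.Fin.Properties using (_≟_; all?; remQuot-combine; combine-remQuot)
open import Data.Integer as ℤ using (ℤ; -_; _+_; _*_; _-_; _≤_; +≤+; -[1+_])
import Data.Integer.Properties as ℤP
open import Data.Integer.Properties using () renaming (_≟_ to _≟ℤ_; _≤?_ to _≤ℤ?_)
open import Data.Integer.Tactic.RingSolver using (solve-∀)
open import Data.Nat as ℕ using (ℕ; zero; suc; _^_; z≤n; s≤s)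
import Data.Nat.Properties as ℕP
open import Data.Nat.Coprimality using (Coprime)
open import Data.Product using (_,_; proj₁; proj₂)
open import Data.Rational as ℚ using (mkℚ; 0ℚ; 1ℚ)
import Data.Rational.Properties as ℚP
import Data.Rational.Unnormalised as ℚᵘ
import Data.Rational.Unnormalised.Properties as ℚᵘP
open import Data.Unit using (tt)
open import Function using (_∘_)
open import Relation.Binary.PropositionalEquality
open import Relation.Nullary using (Dec; ¬_; yes; no; does; map′; _×-dec_; ¬?; _→-dec_)
open import Relation.Nullary.Decidable using (toWitness; dec-true; dec-false)
open import Algebra.Properties.Semiring.Sum ℤP.+-*-semiring
  using (sum; sum-syntax; sum-cong-≗; ∑-distrib-+; ∑-comm; *-distribˡ-sum; *-distribʳ-sum)

𝟙 : Bool → ℤ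
𝟙 b = + ind b

⟦_⟧ : ∀ {A : Set} → Dec A → ℤ
⟦ a? ⟧ = 𝟙 (does a?)

allᵇ? : ∀ {P : Bool → Set} → (∀ b → Dec (P b)) → Dec (∀ b → P b)
allᵇ? P? = map′ (λ { (pt , pf) true → pt ; (pt , pf) false → pf }) (λ h → h true , h false)
                (P? true ×-dec P? false)

sum-const : ∀ n (c : ℤ) → ∑[ i < n ] c ≡ + n * c
sum-const zero    c = sym (ℤP.*-zeroˡ c)
sum-const (suc n) c = begin
  c + ∑[ i < n ] c   ≡⟨ cong (_+_ c) (sum-const n c) ⟩
  c + + n * c        ≡⟨ cong (_+ + n * c) (sym (ℤP.*-identityˡ c)) ⟩
  + 1 * c + + n * c  ≡⟨ sym (ℤP.*-distribʳ-+ c (+ 1) (+ n)) ⟩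
  + suc n * c        ∎
  where open ≡-Reasoning

sum-mono-≤ : ∀ {n} {f g : Fin n → ℤ} → (∀ i → f i ≤ g i) → sum f ≤ sum g
sum-mono-≤ {zero}  f≤g = ℤP.≤-refl
sum-mono-≤ {suc n} f≤g = ℤP.+-mono-≤ (f≤g zero) (sum-mono-≤ (λ i → f≤g (suc i)))

sum-neg : ∀ {n} (f : Fin n → ℤ) → ∑[ i < n ] (- f i) ≡ - sum f
sum-neg {zero}  f = refl
sum-neg {suc n} f = trans (cong (_+_ (- f zero)) (sum-neg (λ i → f (suc i))))
                          (sym (ℤP.neg-distrib-+ (f zero) _))

sum-single : ∀ {n} (f : Fin n → ℤ) k → (∀ i → ¬ i ≡ k → f i ≡ + 0) → sum f ≡ f k
sum-single {suc n} f zero    vanish = begin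
  f zero + ∑[ i < n ] f (suc i)  ≡⟨ cong (_+_ (f zero)) (trans (sum-cong-≗ (λ i → vanish (suc i) λ ())) (sum-const n (+ 0))) ⟩
  f zero + + n * + 0             ≡⟨ cong (_+_ (f zero)) (ℤP.*-zeroʳ (+ n)) ⟩
  f zero + + 0                   ≡⟨ ℤP.+-identityʳ (f zero) ⟩
  f zero                         ∎
  where open ≡-Reasoning
sum-single {suc n} f (suc k) vanish = begin
  f zero + ∑[ i < n ] f (suc i)  ≡⟨ cong (_+ ∑[ i < n ] f (suc i)) (vanish zero λ ()) ⟩
  + 0 + ∑[ i < n ] f (suc i)     ≡⟨ ℤP.+-identityˡ _ ⟩
  ∑[ i < n ] f (suc i)           ≡⟨ sum-single (λ i → f (suc i)) k (λ i i≢k → vanish (suc i) λ { refl → i≢k refl }) ⟩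
  f (suc k)                      ∎
  where open ≡-Reasoning

sum-++ : ∀ m {n} (f : Fin (m ℕ.+ n) → ℤ) → sum f ≡ ∑[ i < m ] f (i ↑ˡ n) + ∑[ j < n ] f (m ↑ʳ j)
sum-++ zero    f = sym (ℤP.+-identityˡ _)
sum-++ (suc m) f = trans (cong (_+_ (f zero)) (sum-++ m (λ i → f (suc i))))
                         (sym (ℤP.+-assoc (f zero) _ _))

sum-combine : ∀ m {n} (f : Fin (m ℕ.* n) → ℤ) → sum f ≡ ∑[ i < m ] ∑[ j < n ] f (combine i j)
sum-combine zero    f = refl
sum-combine (suc m) {n} f = trans (sum-++ n f)
  (cong (_+_ (∑[ j < n ] f (j ↑ˡ (m ℕ.* n)))) (sum-combine m (λ i → f (n ↑ʳ i))))

sum-product : ∀ {m n} (f : Fin m → ℤ) (g : Fin n → ℤ) → sum f * sum g ≡ ∑[ i < m ] ∑[ j < n ] (f i * g j)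
sum-product f g = trans (*-distribʳ-sum (sum g) f) (sum-cong-≗ λ i → *-distribˡ-sum (f i) g)

∑-comm₂ : ∀ {a b c d} (F : Fin a → Fin b → Fin c → Fin d → ℤ) →
          ∑[ i < a ] ∑[ j < b ] ∑[ k < c ] ∑[ l < d ] F i j k l ≡ ∑[ k < c ] ∑[ l < d ] ∑[ i < a ] ∑[ j < b ] F i j k l
∑-comm₂ F = begin
  ∑[ i < _ ] ∑[ j < _ ] ∑[ k < _ ] ∑[ l < _ ] F i j k l  ≡⟨ sum-cong-≗ (λ i → ∑-comm (λ j k → ∑[ l < _ ] F i j k l)) ⟩
  ∑[ i < _ ] ∑[ k < _ ] ∑[ j < _ ] ∑[ l < _ ] F i j k l  ≡⟨ sum-cong-≗ (λ i → sum-cong-≗ λ k → ∑-comm (λ j l → F i j k l)) ⟩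
  ∑[ i < _ ] ∑[ k < _ ] ∑[ l < _ ] ∑[ j < _ ] F i j k l  ≡⟨ ∑-comm (λ i k → ∑[ l < _ ] ∑[ j < _ ] F i j k l) ⟩
  ∑[ k < _ ] ∑[ i < _ ] ∑[ l < _ ] ∑[ j < _ ] F i j k l  ≡⟨ sum-cong-≗ (λ k → ∑-comm (λ i l → ∑[ j < _ ] F i j k l)) ⟩
  ∑[ k < _ ] ∑[ l < _ ] ∑[ i < _ ] ∑[ j < _ ] F i j k l  ∎
  where open ≡-Reasoning

sumFin-ℤ : ∀ {n} (f : Fin n → ℕ) → + sumFin f ≡ ∑[ i < n ] (+ f i)
sumFin-ℤ {zero}  f = refl
sumFin-ℤ {suc n} f = trans (ℤP.pos-+ (f zero) _) (cong (_+_ (+ f zero)) (sumFin-ℤ (λ i → f (suc i))))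

square-nonneg : ∀ i → + 0 ≤ i * i
square-nonneg (+ n)    = subst (+ 0 ≤_) (ℤP.pos-* n n) (+≤+ z≤n)
square-nonneg -[1+ n ] = +≤+ z≤n

≤-+-nonneg : ∀ i {j} → + 0 ≤ j → i ≤ i + j
≤-+-nonneg i 0≤j = ℤP.≤-trans (ℤP.≤-reflexive (sym (ℤP.+-identityʳ i))) (ℤP.+-monoʳ-≤ i 0≤j)

sum-nonneg : ∀ {n} {f : Fin n → ℤ} → (∀ i → + 0 ≤ f i) → + 0 ≤ sum f
sum-nonneg {zero}  f≥0 = ℤP.≤-refl
sum-nonneg {suc n} f≥0 = ℤP.+-mono-≤ (f≥0 zero) (sum-nonneg (λ i → f≥0 (suc i)))

term≤sum : ∀ {n} (f : Fin n → ℤ) k → (∀ i → + 0 ≤ f i) → f k ≤ sum f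
term≤sum {suc n} f zero    f≥0 = ≤-+-nonneg (f zero) (sum-nonneg (λ i → f≥0 (suc i)))
term≤sum {suc n} f (suc k) f≥0 = ℤP.≤-trans (term≤sum (λ i → f (suc i)) k (λ i → f≥0 (suc i)))
  (ℤP.≤-trans (≤-+-nonneg _ (f≥0 zero)) (ℤP.≤-reflexive (ℤP.+-comm _ (f zero))))

*-nonneg : ∀ {a b} → + 0 ≤ a → + 0 ≤ b → + 0 ≤ a * b
*-nonneg {a} {b} a≥0 b≥0 = subst (_≤ a * b) (ℤP.*-zeroʳ a) (ℤP.*-monoˡ-≤-nonNeg a {{ℤ.nonNegative a≥0}} b≥0)

-- Pointwise estimate behind the discrepancy bound: 2·T·(β·r) ≥ −(r² + T²) for β ∈ {0,1}.
product≥-sumOfSquares : ∀ β (T r : ℤ) → - (r * r + T * T) ≤ + 2 * T * (𝟙 β * r)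
product≥-sumOfSquares false T r = ℤP.≤-trans (ℤP.neg-mono-≤ (ℤP.+-mono-≤ (square-nonneg r) (square-nonneg T)))
                                            (ℤP.≤-reflexive (sym (zero-product T r)))
  where zero-product : ∀ T r → + 2 * T * (+ 0 * r) ≡ + 0
        zero-product = solve-∀
product≥-sumOfSquares true T r = ℤP.≤-trans (≤-+-nonneg (- (r * r + T * T)) (square-nonneg (r + T)))
                                           (ℤP.≤-reflexive (expand T r))
  where expand : ∀ T r → - (r * r + T * T) + (r + T) * (r + T) ≡ + 2 * T * (+ 1 * r)
        expand = solve-∀

∑³ : ∀ {l m n} → (Fin l → Fin m → Fin n → ℤ) → ℤ
∑³ {l} {m} {n} F = ∑[ x < l ] ∑[ y < m ] ∑[ z < n ] F x y z

module _ {l m n : ℕ} where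

  ∑³-cong : ∀ {F G : Fin l → Fin m → Fin n → ℤ} → (∀ x y z → F x y z ≡ G x y z) → ∑³ F ≡ ∑³ G
  ∑³-cong F≡G = sum-cong-≗ {l} λ x → sum-cong-≗ {m} λ y → sum-cong-≗ {n} λ z → F≡G x y z

  ∑³-mono-≤ : ∀ {F G : Fin l → Fin m → Fin n → ℤ} → (∀ x y z → F x y z ≤ G x y z) → ∑³ F ≤ ∑³ G
  ∑³-mono-≤ F≤G = sum-mono-≤ λ x → sum-mono-≤ λ y → sum-mono-≤ λ z → F≤G x y z

  ∑³-+ : ∀ (F G : Fin l → Fin m → Fin n → ℤ) → ∑³ (λ x y z → F x y z + G x y z) ≡ ∑³ F + ∑³ G
  ∑³-+ F G = trans (sum-cong-≗ λ x → trans (sum-cong-≗ λ y → ∑-distrib-+ (F x y) (G x y))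
                                           (∑-distrib-+ (λ y → sum (F x y)) (λ y → sum (G x y))))
                   (∑-distrib-+ (λ x → ∑[ y < m ] sum (F x y)) (λ x → ∑[ y < m ] sum (G x y)))

  ∑³-scale : ∀ c (F : Fin l → Fin m → Fin n → ℤ) → ∑³ (λ x y z → c * F x y z) ≡ c * ∑³ F
  ∑³-scale c F = sym (trans (*-distribˡ-sum c (λ x → ∑[ y < m ] sum (F x y)))
                    (sum-cong-≗ λ x → trans (*-distribˡ-sum c (λ y → sum (F x y)))
                                            (sum-cong-≗ λ y → *-distribˡ-sum c (F x y))))

  ∑³-neg : ∀ (F : Fin l → Fin m → Fin n → ℤ) → ∑³ (λ x y z → - F x y z) ≡ - ∑³ F
  ∑³-neg F = trans (∑³-cong λ x y z → sym (ℤP.-1*i≡-i (F x y z)))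
                   (trans (∑³-scale (- + 1) F) (ℤP.-1*i≡-i (∑³ F)))

  ∑³-const : ∀ c → ∑³ {l} {m} {n} (λ _ _ _ → c) ≡ + l * (+ m * (+ n * c))
  ∑³-const c = trans (sum-cong-≗ {l} λ x → trans (sum-cong-≗ {m} λ y → sum-const n c) (sum-const m (+ n * c)))
                     (sum-const l (+ m * (+ n * c)))

sumFin³-ℤ : ∀ {n} (f : Fin n → Fin n → Fin n → ℕ) →
            + sumFin (λ x → sumFin λ y → sumFin λ z → f x y z) ≡ ∑³ (λ x y z → + f x y z)
sumFin³-ℤ f = trans (sumFin-ℤ λ x → sumFin λ y → sumFin λ z → f x y z)
  (sum-cong-≗ λ x → trans (sumFin-ℤ λ y → sumFin λ z → f x y z) (sum-cong-≗ λ y → sumFin-ℤ (f x y)))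

-- The field 𝔽₃ = ℤ/3ℤ, represented by Fin 3 so that statements quantified over it are
-- decidable by all?; each identity below is verified by evaluating it at every point.
𝔽₃ : Set
𝔽₃ = Fin 3

infixl 6 _⊕_ _⊖_
infixl 7 _⊗_

_⊕_ : 𝔽₃ → 𝔽₃ → 𝔽₃
0F ⊕ b  = b
1F ⊕ 0F = 1F
1F ⊕ 1F = 2F
1F ⊕ 2F = 0F
2F ⊕ 0F = 2F
2F ⊕ 1F = 0F
2F ⊕ 2F = 1F

neg : 𝔽₃ → 𝔽₃
neg 0F = 0F
neg 1F = 2F
neg 2F = 1F

_⊖_ : 𝔽₃ → 𝔽₃ → 𝔽₃
a ⊖ b = a ⊕ neg b

_⊗_ : 𝔽₃ → 𝔽₃ → 𝔽₃
0F ⊗ b = 0F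
1F ⊗ b = b
2F ⊗ b = neg b

⊗-comm : ∀ a b → a ⊗ b ≡ b ⊗ a
⊗-comm = toWitness {a? = all? λ _ → all? λ _ → _ ≟ _} tt

difference-bilinear : ∀ a a′ b u u′ → (a ⊗ b ⊕ u) ⊖ (a′ ⊗ b ⊕ u′) ≡ (a ⊖ a′) ⊗ b ⊕ (u ⊖ u′)
difference-bilinear = toWitness {a? = all? λ _ → all? λ _ → all? λ _ → all? λ _ → all? λ _ → _ ≟ _} tt

shift-≟ : ∀ d w s → does (d ⊕ w ≟ s) ≡ does (w ≟ s ⊖ d)
shift-≟ = toWitness {a? = all? λ _ → all? λ _ → all? λ _ → _ ≟ᵇ _} tt

⊖-self : ∀ u → u ⊖ u ≡ 0F
⊖-self = toWitness {a? = all? λ _ → _ ≟ _} tt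

⊖≡0⇒≡ : ∀ a b → a ⊖ b ≡ 0F → a ≡ b
⊖≡0⇒≡ = toWitness {a? = all? λ a → all? λ b → (a ⊖ b ≟ 0F) →-dec (a ≟ b)} tt

unique-solution : ∀ δ s → ¬ δ ≡ 0F → ∑[ b < 3 ] ⟦ 0F ≟ s ⊖ δ ⊗ b ⟧ ≡ + 1
unique-solution = toWitness {a? = all? λ δ → all? λ s → ¬? (δ ≟ 0F) →-dec (_ ≟ℤ _)} tt

-- The balanced indicator of the value c: it has mean zero over w ∈ 𝔽₃.
balanced : 𝔽₃ → 𝔽₃ → ℤ
balanced c w = + 3 * ⟦ w ≟ c ⟧ - + 1

balanced-orthogonality : ∀ u v → ∑[ c < 3 ] (balanced c u * balanced c v) ≡ + 9 * ⟦ u ⊖ v ≟ 0F ⟧ - + 3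
balanced-orthogonality = toWitness {a? = all? λ _ → all? λ _ → _ ≟ℤ _} tt

sumsToOne : 𝔽₃ → 𝔽₃ → 𝔽₃ → Bool
sumsToOne a b c = does (a ⊕ b ⊕ c ≟ 1F)

complement : 𝔽₃ → 𝔽₃ → 𝔽₃
complement a b = 1F ⊖ (a ⊕ b)

sumsToOne-swap₁₂ : ∀ a b c → sumsToOne a b c ≡ sumsToOne b a c
sumsToOne-swap₁₂ = toWitness {a? = all? λ _ → all? λ _ → all? λ _ → _ ≟ᵇ _} tt

sumsToOne-swap₂₃ : ∀ a b c → sumsToOne a b c ≡ sumsToOne a c b
sumsToOne-swap₂₃ = toWitness {a? = all? λ _ → all? λ _ → all? λ _ → _ ≟ᵇ _} tt

sumsToOne-complement : ∀ a b c → does (c ≟ complement a b) ≡ sumsToOne a b c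
sumsToOne-complement = toWitness {a? = all? λ _ → all? λ _ → all? λ _ → _ ≟ᵇ _} tt

-- The link condition on the colours a, b, c of three vertices seen from a fourth vertex:
-- the forced values complement a b, complement a c, complement b c sum to one.
-- (It holds iff a + b + c = 1.)
linkCondition : 𝔽₃ → 𝔽₃ → 𝔽₃ → Bool
linkCondition a b c = sumsToOne (complement a b) (complement a c) (complement b c)

no-K₄-in-link : ∀ a b c d →
  linkCondition a b c ∧ linkCondition a b d ∧ linkCondition a c d ∧ linkCondition b c d ≡ false
no-K₄-in-link = toWitness {a? = all? λ _ → all? λ _ → all? λ _ → all? λ _ → _ ≟ᵇ _} tt

-- The vector space 𝔽₃ᵏ, with vertices encoded as Fin (3 ^ k): a vector in
-- 𝔽₃ᵏ⁺¹ is a leading coordinate together with the remaining vector in 𝔽₃ᵏ.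
V : ℕ → Set
V k = Fin (3 ^ k)

lead : ∀ k → V (suc k) → 𝔽₃
lead k = quotient {3} (3 ^ k)

rest : ∀ k → V (suc k) → V k
rest k = remainder {3} (3 ^ k)

lead-rest-injective : ∀ k {y y′ : V (suc k)} → lead k y ≡ lead k y′ → rest k y ≡ rest k y′ → y ≡ y′
lead-rest-injective k {y} {y′} l≡ r≡ = begin
  y                                ≡⟨ combine-remQuot {3} (3 ^ k) y ⟨
  combine (lead k y) (rest k y)    ≡⟨ cong₂ combine l≡ r≡ ⟩
  combine (lead k y′) (rest k y′)  ≡⟨ combine-remQuot {3} (3 ^ k) y′ ⟩
  y′                               ∎
  where open ≡-Reasoning

lead-combine : ∀ k b (z : V k) → lead k (combine b z) ≡ b
lead-combine k b z = cong proj₁ (remQuot-combine {3} {3 ^ k} b z)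

rest-combine : ∀ k b (z : V k) → rest k (combine b z) ≡ z
rest-combine k b z = cong proj₂ (remQuot-combine {3} {3 ^ k} b z)

φ : ∀ k → V k → V k → 𝔽₃
φ zero    y z = 0F
φ (suc k) y z = lead k y ⊗ lead k z ⊕ φ k (rest k y) (rest k z)

φ-sym : ∀ k y z → φ k y z ≡ φ k z y
φ-sym zero    y z = refl
φ-sym (suc k) y z = cong₂ _⊕_ (⊗-comm (lead k y) (lead k z)) (φ-sym k (rest k y) (rest k z))

φ-combine : ∀ k (y : V (suc k)) b z → φ (suc k) y (combine b z) ≡ lead k y ⊗ b ⊕ φ k (rest k y) z
φ-combine k y b z =
  cong₂ (λ b′ z′ → lead k y ⊗ b′ ⊕ φ k (rest k y) z′) (lead-combine k b z) (rest-combine k b z)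

diffCount : ∀ k → V k → V k → 𝔽₃ → ℤ
diffCount k y y′ s = ∑[ z < 3 ^ k ] ⟦ φ k y z ⊖ φ k y′ z ≟ s ⟧

diffCount-self : ∀ k y s → diffCount k y y s ≡ + (3 ^ k) * ⟦ 0F ≟ s ⟧
diffCount-self k y s = trans (sum-cong-≗ λ z → cong (λ d → ⟦ d ≟ s ⟧) (⊖-self (φ k y z)))
                             (sum-const (3 ^ k) ⟦ 0F ≟ s ⟧)

diffCount-suc : ∀ k (y y′ : V (suc k)) s →
  diffCount (suc k) y y′ s ≡ ∑[ b < 3 ] diffCount k (rest k y) (rest k y′) (s ⊖ (lead k y ⊖ lead k y′) ⊗ b)
diffCount-suc k y y′ s = trans (sum-combine 3 {3 ^ k} λ w → ⟦ φ (suc k) y w ⊖ φ (suc k) y′ w ≟ s ⟧) (sum-cong-≗ λ b → sum-cong-≗ λ z → cong 𝟙 (shifted b z))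
  where
  shifted : ∀ b z → does (φ (suc k) y (combine b z) ⊖ φ (suc k) y′ (combine b z) ≟ s)
                  ≡ does (φ k (rest k y) z ⊖ φ k (rest k y′) z ≟ s ⊖ (lead k y ⊖ lead k y′) ⊗ b)
  shifted b z rewrite φ-combine k y b z | φ-combine k y′ b z
                    | difference-bilinear (lead k y) (lead k y′) b (φ k (rest k y) z) (φ k (rest k y′) z)
                    = shift-≟ ((lead k y ⊖ lead k y′) ⊗ b) _ s

-- A nonzero linear functional on 𝔽₃ᵏ takes every value equally often: for y ≠ y′,
-- z ↦ φ(y,z) − φ(y′,z) attains each s ∈ 𝔽₃ for exactly a third of all z.
diffCount-distinct : ∀ k y y′ s → ¬ y ≡ y′ → + 3 * diffCount k y y′ s ≡ + (3 ^ k)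
diffCount-distinct zero    0F 0F s y≢y′ = ⊥-elim (y≢y′ refl)
diffCount-distinct (suc k) y  y′ s y≢y′ with rest k y ≟ rest k y′
... | yes rests≡ = begin
  + 3 * diffCount (suc k) y y′ s                              ≡⟨ cong (_*_ (+ 3)) (diffCount-suc k y y′ s) ⟩
  + 3 * ∑[ b < 3 ] diffCount k (rest k y) (rest k y′) (s ⊖ δ ⊗ b)
                                 ≡⟨ cong (λ r → + 3 * ∑[ b < 3 ] diffCount k (rest k y) r (s ⊖ δ ⊗ b)) rests≡ ⟨
  + 3 * ∑[ b < 3 ] diffCount k (rest k y) (rest k y) (s ⊖ δ ⊗ b)
                                 ≡⟨ cong (_*_ (+ 3)) (sum-cong-≗ λ b → diffCount-self k (rest k y) (s ⊖ δ ⊗ b)) ⟩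
  + 3 * ∑[ b < 3 ] (+ (3 ^ k) * ⟦ 0F ≟ s ⊖ δ ⊗ b ⟧)          ≡⟨ cong (_*_ (+ 3)) (*-distribˡ-sum (+ (3 ^ k)) λ b → ⟦ 0F ≟ s ⊖ δ ⊗ b ⟧) ⟨
  + 3 * (+ (3 ^ k) * ∑[ b < 3 ] ⟦ 0F ≟ s ⊖ δ ⊗ b ⟧)          ≡⟨ cong (λ c → + 3 * (+ (3 ^ k) * c)) (unique-solution δ s δ≢0) ⟩
  + 3 * (+ (3 ^ k) * + 1)                                     ≡⟨ cong (_*_ (+ 3)) (ℤP.*-identityʳ (+ (3 ^ k))) ⟩
  + 3 * + (3 ^ k)                                             ≡⟨ ℤP.pos-* 3 (3 ^ k) ⟨
  + (3 ^ suc k)                                               ∎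
  where
  open ≡-Reasoning
  δ = lead k y ⊖ lead k y′
  δ≢0 : ¬ δ ≡ 0F
  δ≢0 δ≡0 = y≢y′ (lead-rest-injective k (⊖≡0⇒≡ (lead k y) (lead k y′) δ≡0) rests≡)
... | no rests≢ = begin
  + 3 * diffCount (suc k) y y′ s                              ≡⟨ cong (_*_ (+ 3)) (diffCount-suc k y y′ s) ⟩
  + 3 * ∑[ b < 3 ] diffCount k (rest k y) (rest k y′) (s ⊖ δ ⊗ b)
                                 ≡⟨ *-distribˡ-sum (+ 3) (λ b → diffCount k (rest k y) (rest k y′) (s ⊖ δ ⊗ b)) ⟩
  ∑[ b < 3 ] (+ 3 * diffCount k (rest k y) (rest k y′) (s ⊖ δ ⊗ b))
                                 ≡⟨ sum-cong-≗ (λ b → diffCount-distinct k (rest k y) (rest k y′) (s ⊖ δ ⊗ b) rests≢) ⟩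
  ∑[ b < 3 ] (+ (3 ^ k))                                      ≡⟨ sum-const 3 (+ (3 ^ k)) ⟩
  + 3 * + (3 ^ k)                                             ≡⟨ ℤP.pos-* 3 (3 ^ k) ⟨
  + (3 ^ suc k)                                               ∎
  where
  open ≡-Reasoning
  δ = lead k y ⊖ lead k y′

module Discrepancy (k : ℕ) where

  N : ℕ
  N = 3 ^ k

  -- Gram matrix of the vectors ( balanced c (φ(y,z)) )_{z,c} indexed by y.
  gram : V k → V k → ℤ
  gram y y′ = ∑[ z < N ] ∑[ c < 3 ] (balanced c (φ k y z) * balanced c (φ k y′ z))

  -- By orthogonality, the Gram matrix counts agreements of φ(y,·) and φ(y′,·); hence it is
  -- 6N on the diagonal and, by equidistribution, 0 off it.
  gram-diffCount : ∀ y y′ → gram y y′ ≡ + 9 * diffCount k y y′ 0F - + 3 * + N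
  gram-diffCount y y′ = begin
    gram y y′                                                    ≡⟨ sum-cong-≗ (λ z → balanced-orthogonality (φ k y z) (φ k y′ z)) ⟩
    ∑[ z < N ] (+ 9 * ⟦ φ k y z ⊖ φ k y′ z ≟ 0F ⟧ - + 3)          ≡⟨ ∑-distrib-+ (λ z → + 9 * ⟦ φ k y z ⊖ φ k y′ z ≟ 0F ⟧) (λ _ → - + 3) ⟩
    ∑[ z < N ] (+ 9 * ⟦ φ k y z ⊖ φ k y′ z ≟ 0F ⟧) + ∑[ z < N ] (- + 3)
                    ≡⟨ cong₂ _+_ (sym (*-distribˡ-sum (+ 9) (λ z → ⟦ φ k y z ⊖ φ k y′ z ≟ 0F ⟧))) (sum-const N (- + 3)) ⟩
    + 9 * diffCount k y y′ 0F + + N * - + 3                       ≡⟨ cong (_+_ (+ 9 * diffCount k y y′ 0F)) (rearrange (+ N)) ⟩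
    + 9 * diffCount k y y′ 0F - + 3 * + N                         ∎
    where
    open ≡-Reasoning
    rearrange : ∀ n → n * - + 3 ≡ - (+ 3 * n)
    rearrange = solve-∀

  gram-diag : ∀ y → gram y y ≡ + 6 * + N
  gram-diag y = trans (gram-diffCount y y) (trans (cong (λ d → + 9 * d - + 3 * + N) (diffCount-self k y 0F))
                                                  (simplify (+ N)))
    where simplify : ∀ n → + 9 * (n * + 1) - + 3 * n ≡ + 6 * n
          simplify = solve-∀

  gram-off : ∀ y y′ → ¬ y ≡ y′ → gram y y′ ≡ + 0
  gram-off y y′ y≢y′ = trans (gram-diffCount y y′)
    (trans (cong (λ n → + 9 * diffCount k y y′ 0F - + 3 * n) (sym (diffCount-distinct k y y′ 0F y≢y′)))
           (cancel (diffCount k y y′ 0F)))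
    where cancel : ∀ d → + 9 * d - + 3 * (+ 3 * d) ≡ + 0
          cancel = solve-∀

  module _ (A : V k → Bool) where

    profile : 𝔽₃ → V k → ℤ
    profile c z = ∑[ y < N ] (𝟙 (A y) * balanced c (φ k y z))

    energy-identity : ∑[ z < N ] ∑[ c < 3 ] (profile c z * profile c z)
                    ≡ ∑[ y < N ] ∑[ y′ < N ] (𝟙 (A y) * 𝟙 (A y′) * gram y y′)
    energy-identity = begin
      ∑[ z < N ] ∑[ c < 3 ] (profile c z * profile c z)
          ≡⟨ sum-cong-≗ (λ z → sum-cong-≗ λ c → sum-product (λ y → a y * M c y z) (λ y′ → a y′ * M c y′ z)) ⟩
      ∑[ z < N ] ∑[ c < 3 ] ∑[ y < N ] ∑[ y′ < N ] (a y * M c y z * (a y′ * M c y′ z))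
          ≡⟨ ∑-comm₂ (λ z c y y′ → a y * M c y z * (a y′ * M c y′ z)) ⟩
      ∑[ y < N ] ∑[ y′ < N ] ∑[ z < N ] ∑[ c < 3 ] (a y * M c y z * (a y′ * M c y′ z))
          ≡⟨ sum-cong-≗ (λ y → sum-cong-≗ λ y′ → sum-cong-≗ λ z → sum-cong-≗ λ c →
               regroup (a y) (a y′) (M c y z) (M c y′ z)) ⟩
      ∑[ y < N ] ∑[ y′ < N ] ∑[ z < N ] ∑[ c < 3 ] (a y * a y′ * (M c y z * M c y′ z))
          ≡⟨ sum-cong-≗ (λ y → sum-cong-≗ λ y′ → sum-cong-≗ λ z →
               *-distribˡ-sum (a y * a y′) (λ c → M c y z * M c y′ z)) ⟨
      ∑[ y < N ] ∑[ y′ < N ] ∑[ z < N ] (a y * a y′ * ∑[ c < 3 ] (M c y z * M c y′ z))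
          ≡⟨ sum-cong-≗ (λ y → sum-cong-≗ λ y′ →
               *-distribˡ-sum (a y * a y′) (λ z → ∑[ c < 3 ] (M c y z * M c y′ z))) ⟨
      ∑[ y < N ] ∑[ y′ < N ] (a y * a y′ * gram y y′)  ∎
      where
      open ≡-Reasoning
      a : V k → ℤ
      a y = 𝟙 (A y)
      M : 𝔽₃ → V k → V k → ℤ
      M c y z = balanced c (φ k y z)
      regroup : ∀ p q u v → p * u * (q * v) ≡ p * q * (u * v)
      regroup = solve-∀

    -- Only the diagonal of the Gram matrix contributes, so the energy is at most 6N².
    energy-bound : ∑[ z < N ] ∑[ c < 3 ] (profile c z * profile c z) ≤ + 6 * + N * + N
    energy-bound = begin
      ∑[ z < N ] ∑[ c < 3 ] (profile c z * profile c z)  ≡⟨ energy-identity ⟩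
      ∑[ y < N ] ∑[ y′ < N ] (𝟙 (A y) * 𝟙 (A y′) * gram y y′)
          ≡⟨ sum-cong-≗ (λ y → sum-single (λ y′ → 𝟙 (A y) * 𝟙 (A y′) * gram y y′) y λ y′ y′≢y →
               trans (cong (_*_ (𝟙 (A y) * 𝟙 (A y′))) (gram-off y y′ (λ y≡y′ → y′≢y (sym y≡y′))))
                     (ℤP.*-zeroʳ (𝟙 (A y) * 𝟙 (A y′)))) ⟩
      ∑[ y < N ] (𝟙 (A y) * 𝟙 (A y) * gram y y)  ≡⟨ sum-cong-≗ (λ y → cong (_*_ (𝟙 (A y) * 𝟙 (A y))) (gram-diag y)) ⟩
      ∑[ y < N ] (𝟙 (A y) * 𝟙 (A y) * (+ 6 * + N)) ≤⟨ sum-mono-≤ (λ y → indicator² (A y)) ⟩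
      ∑[ y < N ] (+ 6 * + N)                        ≡⟨ sum-const N (+ 6 * + N) ⟩
      + N * (+ 6 * + N)                             ≡⟨ ℤP.*-comm (+ N) _ ⟩
      + 6 * + N * + N                               ∎
      where
      open ℤP.≤-Reasoning
      indicator² : ∀ β → 𝟙 β * 𝟙 β * (+ 6 * + N) ≤ + 6 * + N
      indicator² true  = ℤP.≤-reflexive (ℤP.*-identityˡ (+ 6 * + N))
      indicator² false = subst (+ 0 ≤_) (ℤP.pos-* 6 N) (+≤+ z≤n)

    -- Discrepancy of φ: for every B ⊆ 𝔽₃ᵏ and every c, the sum
    -- Σ_{y ∈ A, z ∈ B} balanced c (φ(y,z)) is O(N^{3/2}); stated without square roots as
    -- 2·T·S ≥ −(6N² + N·T²) for every T.
    discrepancy : ∀ (B : V k → Bool) c T →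
      - (+ 6 * + N * + N + + N * (T * T)) ≤ + 2 * T * ∑[ z < N ] (𝟙 (B z) * profile c z)
    discrepancy B c T = begin
      - (+ 6 * + N * + N + + N * (T * T))
          ≤⟨ ℤP.neg-mono-≤ (ℤP.+-mono-≤ square-bound (ℤP.≤-reflexive (sum-const N (T * T)))) ⟩
      - (∑[ z < N ] (r z * r z) + ∑[ z < N ] (T * T))
          ≡⟨ cong -_ (∑-distrib-+ (λ z → r z * r z) (λ _ → T * T)) ⟨
      - ∑[ z < N ] (r z * r z + T * T)               ≡⟨ sum-neg (λ z → r z * r z + T * T) ⟨
      ∑[ z < N ] (- (r z * r z + T * T))             ≤⟨ sum-mono-≤ (λ z → product≥-sumOfSquares (B z) T (r z)) ⟩
      ∑[ z < N ] (+ 2 * T * (𝟙 (B z) * r z))         ≡⟨ *-distribˡ-sum (+ 2 * T) (λ z → 𝟙 (B z) * r z) ⟨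
      + 2 * T * ∑[ z < N ] (𝟙 (B z) * r z)           ∎
      where
      open ℤP.≤-Reasoning
      r : V k → ℤ
      r = profile c
      square-bound : ∑[ z < N ] (r z * r z) ≤ + 6 * + N * + N
      square-bound = ℤP.≤-trans
        (sum-mono-≤ λ z → term≤sum (λ c′ → profile c′ z * profile c′ z) c (λ c′ → square-nonneg (profile c′ z)))
        energy-bound

does⇒ : ∀ {A : Set} (a? : Dec A) → does a? ≡ true → A
does⇒ (yes a) _ = a

conjunct₁ : ∀ {a b} → a ∧ b ≡ true → a ≡ true
conjunct₁ {true} _ = refl

≟-sym : ∀ {n} (x y : Fin n) → does (x ≟ y) ≡ does (y ≟ x)
≟-sym x y with x ≟ y
... | yes x≡y = sym (dec-true (y ≟ x) (sym x≡y))
... | no  x≢y = sym (dec-false (y ≟ x) (x≢y ∘ sym))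

distinct3-swap₁₂ : ∀ {n} (x y z : Fin n) → distinct3 x y z ≡ distinct3 y x z
distinct3-swap₁₂ x y z rewrite ≟-sym x y = reorder (not (does (y ≟ x))) (not (does (y ≟ z))) (not (does (x ≟ z)))
  where reorder : ∀ p q r → p ∧ q ∧ r ≡ p ∧ r ∧ q
        reorder = toWitness {a? = allᵇ? λ _ → allᵇ? λ _ → allᵇ? λ _ → _ ≟ᵇ _} tt

distinct3-swap₂₃ : ∀ {n} (x y z : Fin n) → distinct3 x y z ≡ distinct3 x z y
distinct3-swap₂₃ x y z rewrite ≟-sym y z = reverse (not (does (x ≟ y))) (not (does (z ≟ y))) (not (does (x ≟ z)))
  where reverse : ∀ p q r → p ∧ q ∧ r ≡ r ∧ q ∧ p
        reverse = toWitness {a? = allᵇ? λ _ → allᵇ? λ _ → allᵇ? λ _ → _ ≟ᵇ _} tt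

dotEdges : ∀ k → Edges3 (3 ^ k)
dotEdges k x y z = sumsToOne (φ k x y) (φ k x z) (φ k y z) ∧ distinct3 x y z

dotEdges-isHypergraph : ∀ k → IsHypergraph3 (dotEdges k)
dotEdges-isHypergraph k = record
  { sym₁₂ = λ x y z → cong₂ _∧_
      (trans (sumsToOne-swap₂₃ (φ k x y) (φ k x z) (φ k y z))
             (cong (λ a → sumsToOne a (φ k y z) (φ k x z)) (φ-sym k x y)))
      (distinct3-swap₁₂ x y z)
  ; sym₂₃ = λ x y z → cong₂ _∧_
      (trans (sumsToOne-swap₁₂ (φ k x y) (φ k x z) (φ k y z))
             (cong (sumsToOne (φ k x z) (φ k x y)) (φ-sym k y z)))
      (distinct3-swap₂₃ x y z)
  ; loop  = λ x z → trans (cong (λ e → sumsToOne (φ k x x) (φ k x z) (φ k x z) ∧ (not e ∧ not (does (x ≟ z)) ∧ not (does (x ≟ z))))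
                                  (dec-true (x ≟ x) refl))
                            (∧-zeroʳ _)
  }

dotHypergraph : ∀ k → Hypergraph3 (3 ^ k)
dotHypergraph k = record { edge = dotEdges k ; wf = dotEdges-isHypergraph k }

-- K₅-freeness: in a copy x₀,…,x₄ of K₅, put u i = φ(x₀,xᵢ). The edges through x₀ force
-- φ(xᵢ,xⱼ) = complement (u i) (u j), so the edges avoiding x₀ put a K₄ into the link condition.
dotEdges-K₅-free : ∀ k → Free (complete3 5) (dotEdges k)
dotEdges-K₅-free k (f , _ , copy) = true≢false (trans (sym all-links) (no-K₄-in-link (u 1F) (u 2F) (u 3F) (u 4F)))
  where
  u : Fin 5 → 𝔽₃
  u i = φ k (f 0F) (f i)
  forced : ∀ i j → distinct3 0F i j ≡ true → φ k (f i) (f j) ≡ complement (u i) (u j)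
  forced i j d = does⇒ (φ k (f i) (f j) ≟ complement (u i) (u j))
                       (trans (sumsToOne-complement (u i) (u j) _) (conjunct₁ (copy 0F i j d)))
  link : ∀ i j l → distinct3 0F i j ≡ true → distinct3 0F i l ≡ true → distinct3 0F j l ≡ true →
         distinct3 i j l ≡ true → linkCondition (u i) (u j) (u l) ≡ true
  link i j l dij dil djl d = begin
    linkCondition (u i) (u j) (u l)
      ≡⟨ cong₂ (λ a b → sumsToOne a b (complement (u j) (u l))) (forced i j dij) (forced i l dil) ⟨
    sumsToOne (φ k (f i) (f j)) (φ k (f i) (f l)) (complement (u j) (u l))
      ≡⟨ cong (sumsToOne (φ k (f i) (f j)) (φ k (f i) (f l))) (forced j l djl) ⟨
    sumsToOne (φ k (f i) (f j)) (φ k (f i) (f l)) (φ k (f j) (f l))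
      ≡⟨ conjunct₁ (copy i j l d) ⟩
    true ∎
    where open ≡-Reasoning
  all-links : linkCondition (u 1F) (u 2F) (u 3F) ∧ linkCondition (u 1F) (u 2F) (u 4F)
            ∧ linkCondition (u 1F) (u 3F) (u 4F) ∧ linkCondition (u 2F) (u 3F) (u 4F) ≡ true
  all-links = cong₂ _∧_ (link 1F 2F 3F refl refl refl refl) (cong₂ _∧_ (link 1F 2F 4F refl refl refl refl)
                (cong₂ _∧_ (link 1F 3F 4F refl refl refl refl) (link 2F 3F 4F refl refl refl refl)))
  true≢false : true ≡ false → ⊥
  true≢false ()

equal-count : ∀ {n} (x : Fin n) → ∑[ y < n ] ⟦ x ≟ y ⟧ ≡ + 1
equal-count x = trans (sum-single (λ y → ⟦ x ≟ y ⟧) x λ y y≢x → cong 𝟙 (dec-false (x ≟ y) (y≢x ∘ sym)))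
                      (cong 𝟙 (dec-true (x ≟ x) refl))

degenerate-bound : ∀ n → ∑³ {n} {n} {n} (λ x y z → 𝟙 (not (distinct3 x y z))) ≤ + 3 * (+ n * + n)
degenerate-bound n = begin
  ∑³ {n} {n} {n} (λ x y z → 𝟙 (not (distinct3 x y z)))  ≤⟨ ∑³-mono-≤ {n} {n} {n} (λ x y z → union-bound (does (x ≟ y)) (does (y ≟ z)) (does (x ≟ z))) ⟩
  ∑³ (λ x y z → x≡y x y z + (y≡z x y z + x≡z x y z))
      ≡⟨ trans (∑³-+ x≡y _) (cong (_+_ (∑³ x≡y)) (∑³-+ y≡z x≡z)) ⟩
  ∑³ x≡y + (∑³ y≡z + ∑³ x≡z)                 ≡⟨ cong₂ _+_ count-x≡y (cong₂ _+_ count-y≡z count-x≡z) ⟩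
  + n * (+ n * + 1) + (+ n * (+ n * + 1) + + n * (+ n * + 1))  ≡⟨ collect (+ n) ⟩
  + 3 * (+ n * + n)  ∎
  where
  open ℤP.≤-Reasoning
  union-bound : ∀ a b c → 𝟙 (not (not a ∧ not b ∧ not c)) ≤ 𝟙 a + (𝟙 b + 𝟙 c)
  union-bound = toWitness {a? = allᵇ? λ _ → allᵇ? λ _ → allᵇ? λ _ → _ ≤ℤ? _} tt
  collect : ∀ m → m * (m * + 1) + (m * (m * + 1) + m * (m * + 1)) ≡ + 3 * (m * m)
  collect = solve-∀
  x≡y y≡z x≡z : Fin n → Fin n → Fin n → ℤ
  x≡y x y z = ⟦ x ≟ y ⟧
  y≡z x y z = ⟦ y ≟ z ⟧
  x≡z x y z = ⟦ x ≟ z ⟧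
  count-x≡y : ∑³ x≡y ≡ + n * (+ n * + 1)
  count-x≡y = trans (sum-cong-≗ {n} λ x → trans (sum-cong-≗ {n} λ y → sum-const n ⟦ x ≟ y ⟧)
                    (trans (sym (*-distribˡ-sum (+ n) λ y → ⟦ x ≟ y ⟧)) (cong (_*_ (+ n)) (equal-count x))))
                    (sum-const n (+ n * + 1))
  count-y≡z : ∑³ y≡z ≡ + n * (+ n * + 1)
  count-y≡z = trans (sum-cong-≗ {n} λ x → trans (sum-cong-≗ {n} λ y → equal-count {n} y) (sum-const n (+ 1)))
                    (sum-const n (+ n * + 1))
  count-x≡z : ∑³ x≡z ≡ + n * (+ n * + 1)
  count-x≡z = trans (sum-cong-≗ {n} λ x → trans (sum-cong-≗ {n} λ y → equal-count {n} x) (sum-const n (+ 1)))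
                    (sum-const n (+ n * + 1))

colour-split : ∀ p q u v w → 𝟙 (p ∧ q) * balanced (complement u v) w
  ≡ ∑[ a < 3 ] ∑[ b < 3 ] (𝟙 (q ∧ does (v ≟ b)) * (𝟙 (p ∧ does (u ≟ a)) * balanced (complement a b) w))
colour-split = toWitness {a? = allᵇ? λ _ → allᵇ? λ _ → all? λ _ → all? λ _ → all? λ _ → _ ≟ℤ _} tt

edge-weight : ∀ p q e d → 𝟙 (p ∧ q) * (+ 3 * 𝟙 e - + 1) ≤ + 3 * 𝟙 (p ∧ q ∧ e ∧ d) + + 3 * 𝟙 (not d) - 𝟙 (p ∧ q)
edge-weight = toWitness {a? = allᵇ? λ _ → allᵇ? λ _ → allᵇ? λ _ → allᵇ? λ _ → _ ≤ℤ? _} tt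

module Density (k : ℕ) (P Q : PairSet (3 ^ k)) where

  open Discrepancy k

  E K : ℤ
  E = ∑³ λ x y z → 𝟙 (P x y ∧ Q x z ∧ dotEdges k x y z)
  K = ∑³ λ x y z → 𝟙 (P x y ∧ Q x z)

  E-ePQ : + ePQ (dotEdges k) P Q ≡ E
  E-ePQ = sumFin³-ℤ λ x y z → ind (P x y ∧ Q x z ∧ dotEdges k x y z)

  K-sizeK : + sizeK P Q ≡ K
  K-sizeK = sumFin³-ℤ λ x y z → ind (P x y ∧ Q x z)

  total : ℤ
  total = ∑³ λ x y z → 𝟙 (P x y ∧ Q x z) * balanced (complement (φ k x y) (φ k x z)) (φ k y z)

  Pᶜ Qᶜ : V k → 𝔽₃ → V k → Bool
  Pᶜ x a y = P x y ∧ does (φ k x y ≟ a)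
  Qᶜ x b z = Q x z ∧ does (φ k x z ≟ b)

  link-split : ∀ x → ∑[ y < N ] ∑[ z < N ] (𝟙 (P x y ∧ Q x z) * balanced (complement (φ k x y) (φ k x z)) (φ k y z))
                   ≡ ∑[ a < 3 ] ∑[ b < 3 ] ∑[ z < N ] (𝟙 (Qᶜ x b z) * profile (Pᶜ x a) (complement a b) z)
  link-split x = begin
    ∑[ y < N ] ∑[ z < N ] (𝟙 (P x y ∧ Q x z) * balanced (complement (φ k x y) (φ k x z)) (φ k y z))
        ≡⟨ sum-cong-≗ (λ y → sum-cong-≗ λ z → colour-split (P x y) (Q x z) (φ k x y) (φ k x z) (φ k y z)) ⟩
    ∑[ y < N ] ∑[ z < N ] ∑[ a < 3 ] ∑[ b < 3 ] G a b y z  ≡⟨ ∑-comm₂ (λ y z a b → G a b y z) ⟩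
    ∑[ a < 3 ] ∑[ b < 3 ] ∑[ y < N ] ∑[ z < N ] G a b y z  ≡⟨ sum-cong-≗ (λ a → sum-cong-≗ λ b → ∑-comm (G a b)) ⟩
    ∑[ a < 3 ] ∑[ b < 3 ] ∑[ z < N ] ∑[ y < N ] G a b y z
        ≡⟨ sum-cong-≗ (λ a → sum-cong-≗ λ b → sum-cong-≗ λ z →
             *-distribˡ-sum (𝟙 (Qᶜ x b z)) (λ y → 𝟙 (Pᶜ x a y) * balanced (complement a b) (φ k y z))) ⟨
    ∑[ a < 3 ] ∑[ b < 3 ] ∑[ z < N ] (𝟙 (Qᶜ x b z) * profile (Pᶜ x a) (complement a b) z)  ∎
    where
    open ≡-Reasoning
    G : 𝔽₃ → 𝔽₃ → V k → V k → ℤ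
    G a b y z = 𝟙 (Qᶜ x b z) * (𝟙 (Pᶜ x a y) * balanced (complement a b) (φ k y z))

  -- Lower bound: each of the 9N discrepancy sums is bounded below.
  total-lower : ∀ T → - (+ 9 * + N * (+ 6 * + N * + N + + N * (T * T))) ≤ + 2 * T * total
  total-lower T = begin
    - (+ 9 * + N * D)                          ≡⟨ rearrange (+ N) D ⟩
    + N * (+ 3 * (+ 3 * - D))                  ≡⟨ ∑³-const {N} {3} {3} (- D) ⟨
    ∑³ {N} {3} {3} (λ x a b → - D)                      ≤⟨ ∑³-mono-≤ (λ x a b → discrepancy (Pᶜ x a) (Qᶜ x b) (complement a b) T) ⟩
    ∑³ (λ x a b → + 2 * T * S x a b)           ≡⟨ ∑³-scale (+ 2 * T) S ⟩
    + 2 * T * ∑³ S                             ≡⟨ cong (_*_ (+ 2 * T)) (sum-cong-≗ link-split) ⟨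
    + 2 * T * total                            ∎
    where
    open ℤP.≤-Reasoning
    D : ℤ
    D = + 6 * + N * + N + + N * (T * T)
    S : V k → 𝔽₃ → 𝔽₃ → ℤ
    S x a b = ∑[ z < N ] (𝟙 (Qᶜ x b z) * profile (Pᶜ x a) (complement a b) z)
    rearrange : ∀ n d → - (+ 9 * n * d) ≡ n * (+ 3 * (+ 3 * - d))
    rearrange = solve-∀

  total-upper : total ≤ + 3 * E + + 9 * (+ N * + N) - K
  total-upper = begin
    total
        ≡⟨ ∑³-cong (λ x y z → cong (λ e → 𝟙 (P x y ∧ Q x z) * (+ 3 * 𝟙 e - + 1))
                                  (sumsToOne-complement (φ k x y) (φ k x z) (φ k y z))) ⟩
    ∑³ (λ x y z → 𝟙 (P x y ∧ Q x z) * (+ 3 * 𝟙 (sumsToOne (φ k x y) (φ k x z) (φ k y z)) - + 1))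
        ≤⟨ ∑³-mono-≤ (λ x y z → edge-weight (P x y) (Q x z) (sumsToOne (φ k x y) (φ k x z) (φ k y z)) (distinct3 x y z)) ⟩
    ∑³ (λ x y z → + 3 * e x y z + + 3 * d x y z - κ x y z)
        ≡⟨ ∑³-+ (λ x y z → + 3 * e x y z + + 3 * d x y z) (λ x y z → - κ x y z) ⟩
    ∑³ (λ x y z → + 3 * e x y z + + 3 * d x y z) + ∑³ (λ x y z → - κ x y z)
        ≡⟨ cong₂ _+_ (trans (∑³-+ (λ x y z → + 3 * e x y z) (λ x y z → + 3 * d x y z))
                            (cong₂ _+_ (∑³-scale (+ 3) e) (∑³-scale (+ 3) d)))
                     (∑³-neg κ) ⟩
    + 3 * E + + 3 * ∑³ d - K
        ≤⟨ ℤP.+-monoˡ-≤ (- K) (ℤP.+-monoʳ-≤ (+ 3 * E) (ℤP.*-monoˡ-≤-nonNeg (+ 3) (degenerate-bound N))) ⟩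
    + 3 * E + + 3 * (+ 3 * (+ N * + N)) - K    ≡⟨ cong (λ c → + 3 * E + c - K) (ℤP.*-assoc (+ 3) (+ 3) _) ⟨
    + 3 * E + + 9 * (+ N * + N) - K            ∎
    where
    open ℤP.≤-Reasoning
    e d κ : V k → V k → V k → ℤ
    e x y z = 𝟙 (P x y ∧ Q x z ∧ dotEdges k x y z)
    d x y z = 𝟙 (not (distinct3 x y z))
    κ x y z = 𝟙 (P x y ∧ Q x z)

  density-inequality : ∀ T → + 0 ≤ T →
    - (+ 9 * + N * (+ 6 * + N * + N + + N * (T * T))) ≤ + 2 * T * (+ 3 * E + + 9 * (+ N * + N) - K)
  density-inequality T T≥0 = ℤP.≤-trans (total-lower T)
    (ℤP.*-monoˡ-≤-nonNeg (+ 2 * T) {{ℤ.nonNegative (ℤP.*-monoˡ-≤-nonNeg (+ 2) T≥0)}} total-upper)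

lower-order-terms : ∀ (U q p : ℕ) → 1 ℕ.≤ p → 11 ℕ.* q ℕ.≤ U → 1 ℕ.≤ U →
  let u = + U ; n = u * u in
  + q * (+ 54 * (n * n * u) + + 135 * (n * n * n)) ≤ + 18 * + p * u * (n * n * n)
lower-order-terms U q p p≥1 11q≤U U≥1 = begin
  + q * (+ 54 * (n * n * u) + + 135 * (n * n * n))
      ≤⟨ ℤP.*-monoˡ-≤-nonNeg (+ q) (ℤP.+-monoˡ-≤ (+ 135 * (n * n * n)) (ℤP.*-monoˡ-≤-nonNeg (+ 54) u⁵≤u⁶)) ⟩
  + q * (+ 54 * (n * n * n) + + 135 * (n * n * n))
      ≡⟨ collect (+ q) (n * n * n) ⟩
  + 189 * + q * (n * n * n)    ≤⟨ ℤP.*-monoʳ-≤-nonNeg (n * n * n) {{ℤ.nonNegative u⁶≥0}} 189q≤18pu ⟩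
  + 18 * + p * u * (n * n * n) ∎
  where
  open ℤP.≤-Reasoning
  u n : ℤ
  u = + U
  n = u * u
  u≥0 : + 0 ≤ u
  u≥0 = +≤+ z≤n
  u⁶≥0 : + 0 ≤ n * n * n
  u⁶≥0 = *-nonneg (square-nonneg n) (square-nonneg u)
  u⁵≤u⁶ : n * n * u ≤ n * n * n
  u⁵≤u⁶ = begin
    n * n * u          ≡⟨ ℤP.*-identityʳ (n * n * u) ⟨
    n * n * u * + 1    ≤⟨ ℤP.*-monoˡ-≤-nonNeg (n * n * u) {{ℤ.nonNegative (*-nonneg (square-nonneg n) u≥0)}} (+≤+ U≥1) ⟩
    n * n * u * u      ≡⟨ ℤP.*-assoc (n * n) u u ⟩
    n * n * n          ∎
  collect : ∀ q w → q * (+ 54 * w + + 135 * w) ≡ + 189 * q * w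
  collect = solve-∀
  189q≤18pu : + 189 * + q ≤ + 18 * + p * u
  189q≤18pu = subst₂ _≤_ (ℤP.pos-* 189 q) (trans (ℤP.pos-* (18 ℕ.* p) U) (cong (_* u) (ℤP.pos-* 18 p)))
                      (+≤+ (ℕP.≤-trans (ℕP.*-monoˡ-≤ q {189} {198} (ℕP.m≤m+n 189 9))
                           (ℕP.≤-trans (ℕP.≤-reflexive (ℕP.*-assoc 18 11 q))
                           (ℕP.≤-trans (ℕP.*-monoʳ-≤ 18 11q≤U) (ℕP.*-monoˡ-≤ U (ℕP.*-monoʳ-≤ 18 p≥1))))))

absorb-errors : ∀ (U q p : ℕ) (κ ε : ℤ) → 1 ℕ.≤ p → 1 ℕ.≤ q → 11 ℕ.* q ℕ.≤ U →
  let u = + U ; n = u * u ; t = + 3 * u in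
  - (+ 9 * n * (+ 6 * n * n + n * (t * t))) ≤ + 2 * t * (+ 3 * ε + + 9 * (n * n) - κ) →
  κ * + q ≤ + 3 * + q * ε + + 3 * + p * (n * (n * (n * + 1)))
absorb-errors zero q p κ ε p≥1 q≥1 11q≤U _ with () ← ℕP.≤-trans (ℕP.*-monoʳ-≤ 11 q≥1) 11q≤U
absorb-errors U@(suc _) q p κ ε p≥1 q≥1 11q≤U inequality = ℤP.*-cancelˡ-≤-pos (κ * + q) _ (+ 6 * u) (begin
  + 6 * u * (κ * + q)                                         ≡⟨ regroup u κ (+ q) ⟩
  + q * (+ 6 * u * κ)                                         ≤⟨ ℤP.*-monoˡ-≤-nonNeg (+ q) rearranged ⟩
  + q * (+ 18 * u * ε + (+ 54 * (n * n * u) + + 135 * (n * n * n)))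
      ≡⟨ distribute u (+ q) ε (+ 54 * (n * n * u) + + 135 * (n * n * n)) ⟩
  + 6 * u * (+ 3 * + q * ε) + + q * (+ 54 * (n * n * u) + + 135 * (n * n * n))
      ≤⟨ ℤP.+-monoʳ-≤ (+ 6 * u * (+ 3 * + q * ε)) (lower-order-terms U q p p≥1 11q≤U (s≤s z≤n)) ⟩
  + 6 * u * (+ 3 * + q * ε) + + 18 * + p * u * (n * n * n)   ≡⟨ factor u (+ q) (+ p) ε ⟩
  + 6 * u * (+ 3 * + q * ε + + 3 * + p * (n * (n * (n * + 1)))) ∎)
  where
  open ℤP.≤-Reasoning
  u n t : ℤ
  u = + U
  n = u * u
  t = + 3 * u
  cancel : ∀ X c → - X + (c + X) ≡ c
  cancel = solve-∀
  expand : ∀ u κ ε → + 2 * (+ 3 * u) * (+ 3 * ε + + 9 * ((u * u) * (u * u)) - κ)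
                     + (+ 6 * u * κ + + 9 * (u * u) * (+ 6 * (u * u) * (u * u) + (u * u) * ((+ 3 * u) * (+ 3 * u))))
                   ≡ + 18 * u * ε + (+ 54 * ((u * u) * (u * u) * u) + + 135 * ((u * u) * (u * u) * (u * u)))
  expand = solve-∀
  rearranged : + 6 * u * κ ≤ + 18 * u * ε + (+ 54 * (n * n * u) + + 135 * (n * n * n))
  rearranged = subst₂ _≤_ (cancel (+ 9 * n * (+ 6 * n * n + n * (t * t))) (+ 6 * u * κ)) (expand u κ ε)
                          (ℤP.+-monoˡ-≤ (+ 6 * u * κ + + 9 * n * (+ 6 * n * n + n * (t * t))) inequality)
  regroup : ∀ u κ q → + 6 * u * (κ * q) ≡ q * (+ 6 * u * κ)
  regroup = solve-∀
  distribute : ∀ u q ε A → q * (+ 18 * u * ε + A) ≡ + 6 * u * (+ 3 * q * ε) + q * A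
  distribute = solve-∀
  factor : ∀ u q p ε → + 6 * u * (+ 3 * q * ε) + + 18 * p * u * ((u * u) * (u * u) * (u * u))
                     ≡ + 6 * u * (+ 3 * q * ε + + 3 * p * ((u * u) * ((u * u) * ((u * u) * + 1))))
  factor = solve-∀

clear-denominators : ∀ (K M E : ℕ) (n : ℤ) (d : ℕ) .(c : Coprime ℤ.∣ n ∣ (suc d)) →
  + K * + suc d ≤ + 3 * + suc d * + E + + 3 * n * + M →
  (+ 1 / 3) ℚ.* ℕ→ℚ K ℚ.- mkℚ n d c ℚ.* ℕ→ℚ M ℚ.≤ ℕ→ℚ E
clear-denominators K M E n d c integer-bound =
  ℚP.toℚᵘ-cancel-≤ (ℚᵘP.≤-respʳ-≃ (ℚᵘP.≃-sym (embed E)) (ℚᵘP.≤-respˡ-≃ (ℚᵘP.≃-sym unnormalise) cross-multiplied))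
  where
  embed : ∀ m → ℚ.toℚᵘ (ℕ→ℚ m) ℚᵘ.≃ ℚᵘ.mkℚᵘ (+ m) 0
  embed m = ℚP.toℚᵘ-fromℚᵘ (ℚᵘ.mkℚᵘ (+ m) 0)
  third : ℚ.toℚᵘ (+ 1 / 3) ℚᵘ.≃ ℚᵘ.mkℚᵘ (+ 1) 2
  third = ℚP.toℚᵘ-fromℚᵘ (ℚᵘ.mkℚᵘ (+ 1) 2)
  unnormalise : ℚ.toℚᵘ ((+ 1 / 3) ℚ.* ℕ→ℚ K ℚ.- mkℚ n d c ℚ.* ℕ→ℚ M)
                ℚᵘ.≃ ℚᵘ.mkℚᵘ (+ 1) 2 ℚᵘ.* ℚᵘ.mkℚᵘ (+ K) 0 ℚᵘ.- ℚᵘ.mkℚᵘ n d ℚᵘ.* ℚᵘ.mkℚᵘ (+ M) 0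
  unnormalise = ℚᵘP.≃-trans (ℚP.toℚᵘ-homo-+ ((+ 1 / 3) ℚ.* ℕ→ℚ K) (ℚ.- (mkℚ n d c ℚ.* ℕ→ℚ M)))
    (ℚᵘP.+-cong (ℚᵘP.≃-trans (ℚP.toℚᵘ-homo-* (+ 1 / 3) (ℕ→ℚ K)) (ℚᵘP.*-cong third (embed K)))
      (ℚᵘP.≃-trans (ℚP.toℚᵘ-homo‿- (mkℚ n d c ℚ.* ℕ→ℚ M))
        (ℚᵘP.-‿cong (ℚᵘP.≃-trans (ℚP.toℚᵘ-homo-* (mkℚ n d c) (ℕ→ℚ M)) (ℚᵘP.*-cong ℚᵘP.≃-refl (embed M))))))
  cross-multiplied : ℚᵘ.mkℚᵘ (+ 1) 2 ℚᵘ.* ℚᵘ.mkℚᵘ (+ K) 0 ℚᵘ.- ℚᵘ.mkℚᵘ n d ℚᵘ.* ℚᵘ.mkℚᵘ (+ M) 0 ℚᵘ.≤ ℚᵘ.mkℚᵘ (+ E) 0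
  cross-multiplied = ℚᵘ.*≤* (begin
    ((+ 1 * + K) * + suc (d ℕ.* 1) + - (n * + M) * + 3) * + 1
        ≡⟨ cong (λ e → ((+ 1 * + K) * + suc e + - (n * + M) * + 3) * + 1) (ℕP.*-identityʳ d) ⟩
    ((+ 1 * + K) * + suc d + - (n * + M) * + 3) * + 1    ≡⟨ simplifyˡ (+ K) (+ suc d) n (+ M) ⟩
    + K * + suc d - + 3 * n * + M                        ≤⟨ ℤP.+-monoˡ-≤ (- (+ 3 * n * + M)) integer-bound ⟩
    + 3 * + suc d * + E + + 3 * n * + M - + 3 * n * + M  ≡⟨ simplifyʳ (+ E) (+ suc d) (+ 3 * n * + M) ⟩
    + E * (+ 3 * + suc d)                                ≡⟨ cong (λ e → + E * e) (ℤP.pos-* 3 (suc d)) ⟨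
    + E * + (3 ℕ.* suc d)                                ≡⟨ cong (λ e → + E * + (3 ℕ.* suc e)) (ℕP.*-identityʳ d) ⟨
    + E * + (3 ℕ.* suc (d ℕ.* 1))                        ∎)
    where
    open ℤP.≤-Reasoning
    simplifyˡ : ∀ K q n M → ((+ 1 * K) * q + - (n * M) * + 3) * + 1 ≡ K * q - + 3 * n * M
    simplifyˡ = solve-∀
    simplifyʳ : ∀ E q X → + 3 * q * E + X - X ≡ E * (+ 3 * q)
    simplifyʳ = solve-∀

<3^ : ∀ j → j ℕ.< 3 ^ j
<3^ zero    = s≤s z≤n
<3^ (suc j) = ℕP.≤-trans (s≤s (<3^ j))
  (ℕP.≤-trans (ℕP.+-monoˡ-≤ (3 ^ j) (ℕP.m^n>0 3 j)) (ℕP.+-monoʳ-≤ (3 ^ j) (ℕP.m≤m+n (3 ^ j) (3 ^ j ℕ.+ 0))))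

pos-cube : ∀ N → + (N ^ 3) ≡ + N * (+ N * (+ N * + 1))
pos-cube N = trans (ℤP.pos-* N _) (cong (_*_ (+ N)) (trans (ℤP.pos-* N _) (cong (_*_ (+ N)) (ℤP.pos-* N 1))))

dotEdges-dense : ∀ j p d .(c : Coprime (suc p) (suc d)) → 11 ℕ.* suc d ℕ.≤ 3 ^ j →
                 EEDense (dotEdges (j ℕ.+ j)) (+ 1 / 3) (mkℚ (+ suc p) d c)
dotEdges-dense j p d c 11q≤U P Q =
  clear-denominators (sizeK P Q) (N ^ 3) (ePQ (dotEdges (j ℕ.+ j)) P Q) (+ suc p) d c integer-bound
  where
  open Density (j ℕ.+ j) P Q
  U N : ℕ
  U = 3 ^ j
  N = 3 ^ (j ℕ.+ j)
  t : ℤ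
  t = + 3 * + U
  N≡U² : + N ≡ + U * + U
  N≡U² = trans (cong +_ (ℕP.^-distribˡ-+-* 3 j j)) (ℤP.pos-* U U)
  inequality : - (+ 9 * (+ U * + U) * (+ 6 * (+ U * + U) * (+ U * + U) + (+ U * + U) * (t * t)))
               ≤ + 2 * t * (+ 3 * E + + 9 * ((+ U * + U) * (+ U * + U)) - K)
  inequality = subst (λ n → - (+ 9 * n * (+ 6 * n * n + n * (t * t))) ≤ + 2 * t * (+ 3 * E + + 9 * (n * n) - K))
                     N≡U² (density-inequality t (*-nonneg {+ 3} {+ U} (+≤+ z≤n) (+≤+ z≤n)))
  integer-bound : + sizeK P Q * + suc d ≤ + 3 * + suc d * + ePQ (dotEdges (j ℕ.+ j)) P Q + + 3 * + suc p * + (N ^ 3)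
  integer-bound = subst₂ (λ κ ε → κ * + suc d ≤ + 3 * + suc d * ε + + 3 * + suc p * + (N ^ 3)) (sym K-sizeK) (sym E-ePQ)
    (subst (λ m → K * + suc d ≤ + 3 * + suc d * E + + 3 * + suc p * m)
           (sym (trans (pos-cube N) (cong (λ n → n * (n * (n * + 1))) N≡U²)))
           (absorb-errors U (suc d) (suc p) K E (s≤s z≤n) (s≤s z≤n) 11q≤U inequality))

dotEdges-admissible : Admissible (complete3 5) (+ 1 / 3)
dotEdges-admissible (mkℚ (+ suc p) d c) _ n =
  3 ^ k , large , dotHypergraph k , dotEdges-K₅-free k , dotEdges-dense j p d c 11q≤3^j
  where
  j k : ℕ
  j = n ℕ.+ 11 ℕ.* suc d
  k = j ℕ.+ j
  11q≤3^j : 11 ℕ.* suc d ℕ.≤ 3 ^ j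
  11q≤3^j = ℕP.≤-trans (ℕP.m≤n+m (11 ℕ.* suc d) n) (ℕP.<⇒≤ (<3^ j))
  large : 3 ^ k ℕ.≥ n
  large = ℕP.≤-trans (ℕP.m≤m+n n (11 ℕ.* suc d)) (ℕP.≤-trans (ℕP.<⇒≤ (<3^ j)) (ℕP.^-monoʳ-≤ 3 (ℕP.m≤m+n j j)))
dotEdges-admissible η@(mkℚ (+ zero) _ _)   η>0 n with () ← ℚ.positive {η} η>0
dotEdges-admissible η@(mkℚ -[1+ _ ] _ _)  η>0 n with () ← ℚ.positive {η} η>0

mainTheorem3 : πee-≥ (complete3 5) (+ 1 / 3)
mainTheorem3 ε ε>0 = + 1 / 3 , (0≤⅓ , ⅓≤1) , ⅓-ε<⅓ , dotEdges-admissible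
  where
  0≤⅓ : 0ℚ ℚ.≤ + 1 / 3
  0≤⅓ = toWitness {a? = 0ℚ ℚP.≤? (+ 1 / 3)} tt
  ⅓≤1 : + 1 / 3 ℚ.≤ 1ℚ
  ⅓≤1 = toWitness {a? = (+ 1 / 3) ℚP.≤? 1ℚ} tt
  ⅓-ε<⅓ : + 1 / 3 ℚ.- ε ℚ.< + 1 / 3
  ⅓-ε<⅓ = subst (+ 1 / 3 ℚ.- ε ℚ.<_) (ℚP.+-identityʳ (+ 1 / 3)) (ℚP.+-monoʳ-< (+ 1 / 3) (ℚP.neg-antimono-< ε>0))
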